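{- Let $b\ge2$, $d\ge1$, and let $a_1,\dots,a_d$ be positive integers coprime to $b$. For every $t\in\mathbb{Z}$: (i) $S_{(a_1,\dots,a_d;b)}(-t)=\sum_{k=0}^{d}(-1)^k\sum_{1\le i_1<\cdots<i_k\le d}S_{(a_{i_1},\dots,a_{i_k};b)}(t)$; (ii) $S_{(a_1,\dots,a_d;b)}(t+a_1+\cdots+a_d)=\sum_{k=0}^{d}(-1)^{d-k}\sum_{1\le i_1<\cdots<i_k\le d}S_{(a_{i_1},\dots,a_{i_k};b)}(t)$.
   Context: $\xi_b=e^{2\pi i/b}$ and $S_{(a_1,\dots,a_k;b)}(n)=\frac1b\sum_{j=1}^{b-1}\frac{\xi_b^{jn}}{(1-\xi_b^{ja_1})\cdots(1-\xi_b^{ja_k})}$; the $k=0$ term (empty index set) is $S_b(n)=\frac1b\sum_{j=1}^{b-1}\xi_b^{jn}$. -}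

module Defs where

open import Level using (Level; suc; _⊔_)
open import Algebra.Bundles using (CommutativeRing)
open import Data.Nat as ℕ using (ℕ; zero; _<_; _∸_)
open import Data.Integer as ℤ using (ℤ; +_; -[1+_])
open import Data.List using (List; []; _∷_; _++_; map; foldr; filter; length)
open import Data.Product using (_×_)
open import Relation.Nullary using (¬_)
open import Relation.Binary.PropositionalEquality using (_≡_)

record Field (c ℓ : Level) : Set (suc (c ⊔ ℓ)) where
  field
    commutativeRing : CommutativeRing c ℓ
  open CommutativeRing commutativeRing public
  field
    _⁻¹        : Carrier → Carrier
    ⁻¹-inverse : ∀ x → ¬ (x ≈ 0#) → x * (x ⁻¹) ≈ 1#
    0≉1        : ¬ (0# ≈ 1#)

-- All sub-sequences (a_{i1},...,a_{ik}), i1 < ... < ik, of a list,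
-- one for each index subset {i1,...,ik}.
sublists : ∀ {a} {A : Set a} → List A → List (List A)
sublists []       = [] ∷ []
sublists (x ∷ xs) = sublists xs ++ map (x ∷_) (sublists xs)

module FourierDedekind {c ℓ} (F : Field c ℓ) where
  open Field F

  pow : Carrier → ℕ → Carrier
  pow x zero      = 1#
  pow x (ℕ.suc n) = x * pow x n

  zpow : Carrier → ℤ → Carrier
  zpow x (+ n)      = pow x n
  zpow x -[1+ n ]   = (pow x (ℕ.suc n)) ⁻¹

  fromℕ : ℕ → Carrier
  fromℕ zero      = 0#
  fromℕ (ℕ.suc n) = 1# + fromℕ n

  sumL : List Carrier → Carrier
  sumL = foldr _+_ 0#

  prodL : List Carrier → Carrier
  prodL = foldr _*_ 1#

  sumFrom : ℕ → ℕ → (ℕ → Carrier) → Carrier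
  sumFrom lo zero        f = 0#
  sumFrom lo (ℕ.suc len) f = f lo + sumFrom (ℕ.suc lo) len f

  IsPrimitiveRoot : Carrier → ℕ → Set ℓ
  IsPrimitiveRoot ξ b = (pow ξ b ≈ 1#) × (∀ k → 0 < k → k < b → ¬ (pow ξ k ≈ 1#))

  CharZero : Set ℓ
  CharZero = ∀ n → ¬ (fromℕ (ℕ.suc n) ≈ 0#)

  -- Fourier–Dedekind sum S_{(a_1,...,a_k; b)}(n) w.r.t. the root ξ = ξ_b:
  --   (1/b) Σ_{j=1}^{b-1} ξ^{jn} / Π_i (1 - ξ^{j a_i});  k = 0 gives S_b(n).
  S : Carrier → ℕ → List ℕ → ℤ → Carrier
  S ξ b as n =
    (fromℕ b) ⁻¹ * sumFrom 1 (b ∸ 1) (λ j →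
      zpow (pow ξ j) n * prodL (map (λ a → (1# - pow (pow ξ j) a) ⁻¹) as))

  signedSubsetSum : Carrier → ℕ → List ℕ → ℤ → (ℕ → Carrier) → Carrier
  signedSubsetSum ξ b as t sign =
    sumFrom 0 (ℕ.suc (length as)) (λ k →
      sign k * sumL (map (λ s → S ξ b s t)
                         (filter (λ s → length s ℕ.≟ k) (sublists as))))

module Submission where

-- Write g_j(a) = 1/(1 - ξ^{ja}), so that by definition
--   S_{as}(n) = (1/b) Σ_{j=1}^{b-1} ξ^{jn} Π_{a ∈ as} g_j(a).
-- Both identities are proved summand by summand in j, from two facts about
-- g_j at a primitive b-th root of unity ξ (valid since a is coprime to b):
--   reflection  g_j(a) = 1 - g_{b-j}(a)    (as ξ^{ja} ξ^{(b-j)a} = 1),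
--   shift       ξ^{ja} g_j(a) = g_j(a) - 1.
-- On the right-hand side, the signed sum over index subsets grouped by size
-- k equals the sum over all subsets s weighted by sign(|s|), and expanding a
-- product over the index list gives
--   Σ_s (-1)^{|s|} Π_{a∈s} g(a) = Π (1 - g(a)),
--   Σ_s (-1)^{d-|s|} Π_{a∈s} g(a) = Π (g(a) - 1).
-- Hence the right-hand sides are (1/b) Σ_j ξ^{jt} Π (1 - g_j(a)) and
-- (1/b) Σ_j ξ^{jt} Π (g_j(a) - 1).  For (i) reindex j ↦ b - j and apply
-- reflection (note ξ^{-(b-j)t} = ξ^{jt}); for (ii) apply shift to each factor.

open import Defs
open import Data.Nat as ℕ using (ℕ; zero; suc; _≤_; _<_; _∸_; z≤n; s≤s)
import Data.Nat.Properties as ℕP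
open import Data.Nat.Coprimality using (Coprime; coprime-divisor)
import Data.Nat.Coprimality as Coprimality
open import Data.Nat.Divisibility using (_∣_; ∣⇒≤; m%n≡0⇒n∣m)
open import Data.Nat.DivMod using (_%_; _/_; m≡m%n+[m/n]*n; m%n<n)
open import Data.Nat.ListAction using (sum)
open import Data.Integer as ℤ using (ℤ; +_; -[1+_])
import Data.Integer.Properties as ℤP
open import Data.List using (List; []; _∷_; _++_; map; filter; length)
open import Data.List.Properties using (map-++; map-∘; filter-accept; filter-reject)
open import Data.List.Relation.Unary.All as All using (All; []; _∷_)
import Data.List.Relation.Unary.All.Properties as AllP
open import Data.Product using (_×_; _,_; proj₁; proj₂)
open import Data.Empty using (⊥-elim)
open import Relation.Nullary using (¬_; yes; no)
open import Relation.Binary.PropositionalEquality as PE using (_≡_; _≢_)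

module FourierDedekindProperties {c ℓ} (F : Field c ℓ) where
  open Field F
  open FourierDedekind F
  open import Relation.Binary.Reasoning.Setoid setoid
  open import Algebra.Properties.Ring ring using (-1*x≈-x; [y-z]x≈yx-zx; x[y-z]≈xy-xz; -‿distribʳ-*)
  open import Algebra.Properties.AbelianGroup +-abelianGroup using (⁻¹-anti-homo‿-; xyx⁻¹≈y)
  open import Algebra.Properties.Group +-group using (x∙y⁻¹≈ε⇒x≈y; ⁻¹-involutive)
  open import Algebra.Properties.CommutativeSemigroup *-commutativeSemigroup using (interchange; x∙yz≈y∙xz)
  open import Algebra.Properties.CommutativeSemigroup +-commutativeSemigroup
    using () renaming (interchange to +-interchange; xy∙z≈xz∙y to +-rearrange)
  open import Algebra.Properties.CommutativeSemiring.Exp commutativeSemiring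
    using (_^_; ^-congˡ; ^-homo-*; ^-assocʳ; ^-distrib-*)

  inverse-unique : ∀ {p u v} → p * u ≈ 1# → p * v ≈ 1# → u ≈ v
  inverse-unique {p} {u} {v} pu≈1 pv≈1 = begin
    u            ≈⟨ *-identityʳ u ⟨
    u * 1#       ≈⟨ *-congˡ pv≈1 ⟨
    u * (p * v)  ≈⟨ *-assoc u p v ⟨
    (u * p) * v  ≈⟨ *-congʳ (*-comm u p) ⟩
    (p * u) * v  ≈⟨ *-congʳ pu≈1 ⟩
    1# * v       ≈⟨ *-identityˡ v ⟩
    v            ∎

  unit⇒≉0 : ∀ {x y} → x * y ≈ 1# → ¬ (x ≈ 0#)
  unit⇒≉0 {x} {y} xy≈1 x≈0 = 0≉1 (begin
    0#      ≈⟨ zeroˡ y ⟨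
    0# * y  ≈⟨ *-congʳ x≈0 ⟨
    x * y   ≈⟨ xy≈1 ⟩
    1#      ∎)

  *-≉0 : ∀ {u v} → ¬ (u ≈ 0#) → ¬ (v ≈ 0#) → ¬ (u * v ≈ 0#)
  *-≉0 {u} {v} u≉0 v≉0 uv≈0 = u≉0 (begin
    u                ≈⟨ *-identityʳ u ⟨
    u * 1#           ≈⟨ *-congˡ (⁻¹-inverse v v≉0) ⟨
    u * (v * v ⁻¹)   ≈⟨ *-assoc u v (v ⁻¹) ⟨
    (u * v) * v ⁻¹   ≈⟨ *-congʳ uv≈0 ⟩
    0# * v ⁻¹        ≈⟨ zeroˡ (v ⁻¹) ⟩
    0#               ∎)

  1-y≉0 : ∀ {y} → ¬ (y ≈ 1#) → ¬ (1# - y ≈ 0#)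
  1-y≉0 y≉1 1-y≈0 = y≉1 (sym (x∙y⁻¹≈ε⇒x≈y 1# _ 1-y≈0))

  [1-y]x≈x-yx : ∀ x y → (1# - y) * x ≈ x - y * x
  [1-y]x≈x-yx x y = trans ([y-z]x≈yx-zx x 1# y) (+-congʳ (*-identityˡ x))

  -- `pow` is the library's exponentiation, whose laws are reused below.
  pow≡^ : ∀ x n → pow x n ≡ x ^ n
  pow≡^ x zero    = PE.refl
  pow≡^ x (suc n) = PE.cong (x *_) (pow≡^ x n)

  pow-cong : ∀ {x y} n → x ≈ y → pow x n ≈ pow y n
  pow-cong {x} {y} n x≈y rewrite pow≡^ x n | pow≡^ y n = ^-congˡ n x≈y

  pow-+ : ∀ x m n → pow x (m ℕ.+ n) ≈ pow x m * pow x n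
  pow-+ x m n rewrite pow≡^ x (m ℕ.+ n) | pow≡^ x m | pow≡^ x n = ^-homo-* x m n

  pow-* : ∀ x m n → pow (pow x m) n ≈ pow x (m ℕ.* n)
  pow-* x m n rewrite pow≡^ (pow x m) n | pow≡^ x m | pow≡^ x (m ℕ.* n) = ^-assocʳ x m n

  pow-distrib : ∀ x y n → pow (x * y) n ≈ pow x n * pow y n
  pow-distrib x y n rewrite pow≡^ (x * y) n | pow≡^ x n | pow≡^ y n = ^-distrib-* x y n

  pow-1# : ∀ n → pow 1# n ≈ 1#
  pow-1# zero    = refl
  pow-1# (suc n) = trans (*-identityˡ _) (pow-1# n)

  pow-≉0 : ∀ {x} n → ¬ (x ≈ 0#) → ¬ (pow x n ≈ 0#)
  pow-≉0 zero    x≉0 1≈0 = 0≉1 (sym 1≈0)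
  pow-≉0 (suc n) x≉0     = *-≉0 x≉0 (pow-≉0 n x≉0)

  pow-inverse : ∀ {x y} n → x * y ≈ 1# → pow x n * pow y n ≈ 1#
  pow-inverse {x} {y} n xy≈1 =
    trans (sym (pow-distrib x y n)) (trans (pow-cong n xy≈1) (pow-1# n))

  zpow-neg : ∀ {x y} → x * y ≈ 1# → ∀ t → zpow x (ℤ.- t) ≈ zpow y t
  zpow-neg xy≈1 (+ zero)  = refl
  zpow-neg xy≈1 (+ suc n) = sym (inverse-unique (pow-inverse (suc n) xy≈1)
    (⁻¹-inverse _ (pow-≉0 (suc n) (unit⇒≉0 xy≈1))))
  zpow-neg {x} {y} xy≈1 -[1+ n ] =
    inverse-unique (trans (*-comm _ _) (pow-inverse (suc n) xy≈1))
      (⁻¹-inverse _ (pow-≉0 (suc n) (unit⇒≉0 (trans (*-comm y x) xy≈1))))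

  zpow-suc : ∀ {x} → ¬ (x ≈ 0#) → ∀ t → zpow x (ℤ.suc t) ≈ zpow x t * x
  zpow-suc x≉0 (+ n) = *-comm _ _
  zpow-suc {x} x≉0 -[1+ zero ] = sym (begin
    (x * 1#) ⁻¹ * x          ≈⟨ *-congˡ (*-identityʳ x) ⟨
    (x * 1#) ⁻¹ * (x * 1#)   ≈⟨ *-comm _ _ ⟩
    (x * 1#) * (x * 1#) ⁻¹   ≈⟨ ⁻¹-inverse _ (pow-≉0 1 x≉0) ⟩
    1#                       ∎)
  zpow-suc {x} x≉0 -[1+ suc n ] = inverse-unique (⁻¹-inverse _ (pow-≉0 (suc n) x≉0)) (begin
    xⁿ⁺¹ * (xⁿ⁺² ⁻¹ * x)  ≈⟨ *-congˡ (*-comm _ x) ⟩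
    xⁿ⁺¹ * (x * xⁿ⁺² ⁻¹)  ≈⟨ *-assoc _ x _ ⟨
    (xⁿ⁺¹ * x) * xⁿ⁺² ⁻¹  ≈⟨ *-congʳ (*-comm _ x) ⟩
    xⁿ⁺² * xⁿ⁺² ⁻¹        ≈⟨ ⁻¹-inverse _ (pow-≉0 (suc (suc n)) x≉0) ⟩
    1#                    ∎)
    where
    xⁿ⁺¹ xⁿ⁺² : Carrier
    xⁿ⁺¹ = pow x (suc n)
    xⁿ⁺² = pow x (suc (suc n))

  zpow-+ : ∀ {x} → ¬ (x ≈ 0#) → ∀ t m → zpow x (t ℤ.+ + m) ≈ zpow x t * pow x m
  zpow-+ {x} x≉0 t zero = begin
    zpow x (t ℤ.+ + 0)  ≡⟨ PE.cong (zpow x) (ℤP.+-identityʳ t) ⟩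
    zpow x t            ≈⟨ *-identityʳ _ ⟨
    zpow x t * 1#       ∎
  zpow-+ {x} x≉0 t (suc m) = begin
    zpow x (t ℤ.+ + suc m)       ≡⟨ PE.cong (zpow x) t+[1+m]≡1+[t+m] ⟩
    zpow x (ℤ.suc (t ℤ.+ + m))   ≈⟨ zpow-suc x≉0 (t ℤ.+ + m) ⟩
    zpow x (t ℤ.+ + m) * x       ≈⟨ *-congʳ (zpow-+ x≉0 t m) ⟩
    (zpow x t * pow x m) * x     ≈⟨ *-assoc _ _ _ ⟩
    zpow x t * (pow x m * x)     ≈⟨ *-congˡ (*-comm _ x) ⟩
    zpow x t * pow x (suc m)     ∎
    where
    t+[1+m]≡1+[t+m] : t ℤ.+ + suc m ≡ ℤ.suc (t ℤ.+ + m)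
    t+[1+m]≡1+[t+m] = PE.trans (PE.sym (ℤP.+-assoc t (+ 1) (+ m)))
      (PE.trans (PE.cong (ℤ._+ + m) (ℤP.+-comm t (+ 1))) (ℤP.+-assoc (+ 1) t (+ m)))

  sumFrom-shift : ∀ lo n (f : ℕ → Carrier) → sumFrom (suc lo) n f ≡ sumFrom lo n (λ i → f (suc i))
  sumFrom-shift lo zero    f = PE.refl
  sumFrom-shift lo (suc n) f = PE.cong (λ z → f (suc lo) + z) (sumFrom-shift (suc lo) n f)

  sumFrom-cong-range : ∀ lo n {f g : ℕ → Carrier} →
    (∀ i → lo ≤ i → i < lo ℕ.+ n → f i ≈ g i) → sumFrom lo n f ≈ sumFrom lo n g
  sumFrom-cong-range lo zero    f≈g = refl
  sumFrom-cong-range lo (suc n) f≈g =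
    +-cong (f≈g lo ℕP.≤-refl (ℕP.m<m+n lo (s≤s z≤n)))
      (sumFrom-cong-range (suc lo) n (λ i lo<i i<end →
        f≈g i (ℕP.<⇒≤ lo<i) (PE.subst (i <_) (PE.sym (ℕP.+-suc lo n)) i<end)))

  sumFrom-cong : ∀ lo n {f g : ℕ → Carrier} → (∀ i → f i ≈ g i) → sumFrom lo n f ≈ sumFrom lo n g
  sumFrom-cong lo n f≈g = sumFrom-cong-range lo n (λ i _ _ → f≈g i)

  sumFrom-+ : ∀ lo n (f g : ℕ → Carrier) →
    sumFrom lo n (λ i → f i + g i) ≈ sumFrom lo n f + sumFrom lo n g
  sumFrom-+ lo zero    f g = sym (+-identityˡ 0#)
  sumFrom-+ lo (suc n) f g = begin
    (f lo + g lo) + sumFrom (suc lo) n (λ i → f i + g i)  ≈⟨ +-congˡ (sumFrom-+ (suc lo) n f g) ⟩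
    (f lo + g lo) + (Σf + Σg)                            ≈⟨ +-interchange (f lo) (g lo) Σf Σg ⟩
    (f lo + Σf) + (g lo + Σg)                            ∎
    where
    Σf Σg : Carrier
    Σf = sumFrom (suc lo) n f
    Σg = sumFrom (suc lo) n g

  sumFrom-*ˡ : ∀ lo n x (f : ℕ → Carrier) → sumFrom lo n (λ i → x * f i) ≈ x * sumFrom lo n f
  sumFrom-*ˡ lo zero    x f = sym (zeroʳ x)
  sumFrom-*ˡ lo (suc n) x f = trans (+-congˡ (sumFrom-*ˡ (suc lo) n x f)) (sym (distribˡ x _ _))

  sumFrom-0# : ∀ lo n → sumFrom lo n (λ _ → 0#) ≈ 0#
  sumFrom-0# lo zero    = refl
  sumFrom-0# lo (suc n) = trans (+-identityˡ _) (sumFrom-0# (suc lo) n)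

  sumFrom-bump : ∀ lo n m {f g : ℕ → Carrier} x → lo ≤ m → m < lo ℕ.+ n →
    (∀ k → k ≢ m → f k ≈ g k) → f m ≈ g m + x → sumFrom lo n f ≈ sumFrom lo n g + x
  sumFrom-bump lo zero m x lo≤m m<lo+0 _ _ =
    ⊥-elim (ℕP.<-irrefl PE.refl (ℕP.<-≤-trans m<lo+0 (PE.subst (_≤ m) (PE.sym (ℕP.+-identityʳ lo)) lo≤m)))
  sumFrom-bump lo (suc n) m {f} {g} x lo≤m m<end f≈g fm≈gm+x with lo ℕP.≟ m
  ... | yes PE.refl = begin
    f lo + sumFrom (suc lo) n f  ≈⟨ +-cong fm≈gm+x (sumFrom-cong-range (suc lo) n
                                      (λ k lo<k _ → f≈g k (ℕP.>⇒≢ lo<k))) ⟩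
    (g lo + x) + sumFrom (suc lo) n g  ≈⟨ +-rearrange (g lo) x _ ⟩
    (g lo + sumFrom (suc lo) n g) + x  ∎
  ... | no lo≢m = begin
    f lo + sumFrom (suc lo) n f        ≈⟨ +-cong (f≈g lo lo≢m)
      (sumFrom-bump (suc lo) n m x (ℕP.≤∧≢⇒< lo≤m lo≢m) (PE.subst (m <_) (ℕP.+-suc lo n) m<end)
        f≈g fm≈gm+x) ⟩
    g lo + (sumFrom (suc lo) n g + x)  ≈⟨ +-assoc _ _ _ ⟨
    (g lo + sumFrom (suc lo) n g) + x  ∎

  sumFrom-last : ∀ lo n (f : ℕ → Carrier) → sumFrom lo (suc n) f ≈ sumFrom lo n f + f (lo ℕ.+ n)
  sumFrom-last lo zero f = begin
    f lo + 0#       ≈⟨ +-comm _ _ ⟩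
    0# + f lo       ≡⟨ PE.cong (λ k → 0# + f k) (PE.sym (ℕP.+-identityʳ lo)) ⟩
    0# + f (lo ℕ.+ 0) ∎
  sumFrom-last lo (suc n) f = begin
    f lo + sumFrom (suc lo) (suc n) f                 ≈⟨ +-congˡ (sumFrom-last (suc lo) n f) ⟩
    f lo + (sumFrom (suc lo) n f + f (suc lo ℕ.+ n))  ≈⟨ +-assoc _ _ _ ⟨
    (f lo + sumFrom (suc lo) n f) + f (suc lo ℕ.+ n)  ≡⟨ PE.cong (λ k → sumFrom lo (suc n) f + f k) (PE.sym (ℕP.+-suc lo n)) ⟩
    sumFrom lo (suc n) f + f (lo ℕ.+ suc n)           ∎

  sumFrom-reflect : ∀ n (f : ℕ → Carrier) → sumFrom 1 n f ≈ sumFrom 1 n (λ j → f (suc n ∸ j))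
  sumFrom-reflect zero    f = refl
  sumFrom-reflect (suc n) f = begin
    sumFrom 1 (suc n) f                               ≈⟨ sumFrom-last 1 n f ⟩
    sumFrom 1 n f + f (suc n)                         ≈⟨ +-congʳ (sumFrom-reflect n f) ⟩
    sumFrom 1 n (λ j → f (suc n ∸ j)) + f (suc n)     ≈⟨ +-comm _ _ ⟩
    f (suc n) + sumFrom 1 n (λ j → f (suc n ∸ j))     ≡⟨ PE.cong (λ z → f (suc n) + z) (PE.sym (sumFrom-shift 1 n _)) ⟩
    sumFrom 1 (suc n) (λ j → f (suc (suc n) ∸ j))     ∎

  sumL-++ : ∀ xs ys → sumL (xs ++ ys) ≈ sumL xs + sumL ys
  sumL-++ []       ys = sym (+-identityˡ _)
  sumL-++ (x ∷ xs) ys = trans (+-congˡ (sumL-++ xs ys)) (sym (+-assoc _ _ _))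

  sumL-*ˡ : ∀ {A : Set} x (f : A → Carrier) (L : List A) → sumL (map (λ s → x * f s) L) ≈ x * sumL (map f L)
  sumL-*ˡ x f []      = sym (zeroʳ x)
  sumL-*ˡ x f (s ∷ L) = trans (+-congˡ (sumL-*ˡ x f L)) (sym (distribˡ x _ _))

  sumL-cong : ∀ {A : Set} {f g : A → Carrier} (L : List A) → (∀ s → f s ≈ g s) → sumL (map f L) ≈ sumL (map g L)
  sumL-cong []      f≈g = refl
  sumL-cong (s ∷ L) f≈g = +-cong (f≈g s) (sumL-cong L f≈g)

  sumL-congAll : ∀ {A : Set} {P : A → Set} {f g : A → Carrier} (L : List A) → All P L →
    (∀ s → P s → f s ≈ g s) → sumL (map f L) ≈ sumL (map g L)
  sumL-congAll []      []       f≈g = refl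
  sumL-congAll (s ∷ L) (p ∷ ps) f≈g = +-cong (f≈g s p) (sumL-congAll L ps f≈g)

  prodL-congAll : ∀ {A : Set} {P : A → Set} {f g : A → Carrier} (L : List A) → All P L →
    (∀ s → P s → f s ≈ g s) → prodL (map f L) ≈ prodL (map g L)
  prodL-congAll []      []       f≈g = refl
  prodL-congAll (s ∷ L) (p ∷ ps) f≈g = *-cong (f≈g s p) (prodL-congAll L ps f≈g)

  sumL-sumFrom-comm : ∀ {A : Set} lo n (G : A → ℕ → Carrier) (L : List A) →
    sumL (map (λ s → sumFrom lo n (G s)) L) ≈ sumFrom lo n (λ j → sumL (map (λ s → G s j) L))
  sumL-sumFrom-comm lo n G []      = sym (sumFrom-0# lo n)
  sumL-sumFrom-comm lo n G (s ∷ L) =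
    trans (+-congˡ (sumL-sumFrom-comm lo n G L)) (sym (sumFrom-+ lo n _ _))

  prodL-pow-split : ∀ x (h : ℕ → Carrier) as →
    prodL (map (λ a → pow x a * h a) as) ≈ pow x (sum as) * prodL (map h as)
  prodL-pow-split x h []       = sym (*-identityˡ 1#)
  prodL-pow-split x h (a ∷ as) = begin
    (pow x a * h a) * prodL (map (λ a → pow x a * h a) as)  ≈⟨ *-congˡ (prodL-pow-split x h as) ⟩
    (pow x a * h a) * (pow x (sum as) * prodL (map h as))   ≈⟨ interchange _ _ _ _ ⟩
    (pow x a * pow x (sum as)) * (h a * prodL (map h as))   ≈⟨ *-congʳ (pow-+ x a (sum as)) ⟨
    pow x (a ℕ.+ sum as) * (h a * prodL (map h as))         ∎

  -- Sums over index subsets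

  sublists-length : ∀ {A : Set} (as : List A) → All (λ s → length s ≤ length as) (sublists as)
  sublists-length []       = z≤n ∷ []
  sublists-length (x ∷ xs) = AllP.++⁺ (All.map ℕP.m≤n⇒m≤1+n (sublists-length xs))
                                       (AllP.map⁺ (All.map s≤s (sublists-length xs)))

  sum-by-size : ∀ {A : Set} (size : A → ℕ) d (sign : ℕ → Carrier) (F : A → Carrier) (L : List A) →
    All (λ s → size s ≤ d) L →
    sumFrom 0 (suc d) (λ k → sign k * sumL (map F (filter (λ s → size s ℕ.≟ k) L)))
      ≈ sumL (map (λ s → sign (size s) * F s) L)
  sum-by-size size d sign F [] [] =
    trans (sumFrom-cong 0 (suc d) (λ k → zeroʳ (sign k))) (sumFrom-0# 0 (suc d))
  sum-by-size {A} size d sign F (s ∷ L) (s≤d ∷ L≤d) = begin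
    sumFrom 0 (suc d) (term (s ∷ L))                    ≈⟨ sumFrom-bump 0 (suc d) (size s) (sign (size s) * F s)
                                                             z≤n (s≤s s≤d) other-size own-size ⟩
    sumFrom 0 (suc d) (term L) + sign (size s) * F s    ≈⟨ +-comm _ _ ⟩
    sign (size s) * F s + sumFrom 0 (suc d) (term L)    ≈⟨ +-congˡ (sum-by-size size d sign F L L≤d) ⟩
    sign (size s) * F s + sumL (map (λ s → sign (size s) * F s) L) ∎
    where
    term : List A → ℕ → Carrier
    term M k = sign k * sumL (map F (filter (λ s → size s ℕ.≟ k) M))
    other-size : ∀ k → k ≢ size s → term (s ∷ L) k ≈ term L k
    other-size k k≢ = reflexive (PE.cong (λ M → sign k * sumL (map F M))
      (filter-reject (λ s → size s ℕ.≟ k) (λ eq → k≢ (PE.sym eq))))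
    own-size : term (s ∷ L) (size s) ≈ term L (size s) + sign (size s) * F s
    own-size = begin
      term (s ∷ L) (size s)  ≡⟨ PE.cong (λ M → sign (size s) * sumL (map F M)) (filter-accept (λ s′ → size s′ ℕ.≟ size s) PE.refl) ⟩
      sign (size s) * (F s + sumL (map F (filter (λ s′ → size s′ ℕ.≟ size s) L)))  ≈⟨ distribˡ _ _ _ ⟩
      sign (size s) * F s + term L (size s)  ≈⟨ +-comm _ _ ⟩
      term L (size s) + sign (size s) * F s  ∎

  sumL-sublists-∷ : ∀ {A : Set} (w : List A → Carrier) x xs →
    sumL (map w (sublists (x ∷ xs))) ≈ sumL (map w (sublists xs)) + sumL (map (λ s → w (x ∷ s)) (sublists xs))
  sumL-sublists-∷ w x xs = begin
    sumL (map w (A ++ map (x ∷_) A))          ≡⟨ PE.cong sumL (map-++ w A (map (x ∷_) A)) ⟩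
    sumL (map w A ++ map w (map (x ∷_) A))    ≈⟨ sumL-++ (map w A) _ ⟩
    sumL (map w A) + sumL (map w (map (x ∷_) A))  ≡⟨ PE.cong (λ M → sumL (map w A) + sumL M) (PE.sym (map-∘ A)) ⟩
    sumL (map w A) + sumL (map (λ s → w (x ∷ s)) A) ∎
    where A = sublists xs

  expand-1-g : ∀ {A : Set} (g : A → Carrier) as →
    sumL (map (λ s → pow (- 1#) (length s) * prodL (map g s)) (sublists as)) ≈ prodL (map (λ a → 1# - g a) as)
  expand-1-g g []       = trans (+-identityʳ _) (*-identityˡ 1#)
  expand-1-g g (x ∷ xs) = begin
    sumL (map w (sublists (x ∷ xs)))                   ≈⟨ sumL-sublists-∷ w x xs ⟩
    E + sumL (map (λ s → (- 1# * pow (- 1#) (length s)) * (g x * prodL (map g s))) A)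
                                                       ≈⟨ +-congˡ (sumL-cong A (λ s → interchange _ _ _ _)) ⟩
    E + sumL (map (λ s → (- 1# * g x) * w s) A)        ≈⟨ +-congˡ (sumL-*ˡ _ w A) ⟩
    E + (- 1# * g x) * E                               ≈⟨ +-cong (*-identityˡ E) (*-congʳ (sym (-1*x≈-x (g x)))) ⟨
    1# * E + (- g x) * E                               ≈⟨ distribʳ E 1# (- g x) ⟨
    (1# - g x) * E                                     ≈⟨ *-congˡ (expand-1-g g xs) ⟩
    (1# - g x) * prodL (map (λ a → 1# - g a) xs)       ∎
    where
    w : _ → Carrier
    w s = pow (- 1#) (length s) * prodL (map g s)
    A = sublists xs
    E = sumL (map w A)

  expand-g-1 : ∀ {A : Set} (g : A → Carrier) as →
    sumL (map (λ s → pow (- 1#) (length as ∸ length s) * prodL (map g s)) (sublists as))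
      ≈ prodL (map (λ a → g a - 1#) as)
  expand-g-1 g []       = trans (+-identityʳ _) (*-identityˡ 1#)
  expand-g-1 g (x ∷ xs) = begin
    sumL (map w (sublists (x ∷ xs)))                   ≈⟨ sumL-sublists-∷ w x xs ⟩
    sumL (map w A) + sumL (map (λ s → pow (- 1#) (d ∸ length s) * (g x * prodL (map g s))) A)
      ≈⟨ +-cong (sumL-congAll A (sublists-length xs) sign-step) (sumL-cong A (λ s → x∙yz≈y∙xz _ _ _)) ⟩
    sumL (map (λ s → - 1# * w′ s) A) + sumL (map (λ s → g x * w′ s) A)
      ≈⟨ +-cong (sumL-*ˡ _ w′ A) (sumL-*ˡ _ w′ A) ⟩
    - 1# * E + g x * E                                 ≈⟨ +-comm _ _ ⟩
    g x * E + - 1# * E                                 ≈⟨ distribʳ E (g x) (- 1#) ⟨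
    (g x - 1#) * E                                     ≈⟨ *-congˡ (expand-g-1 g xs) ⟩
    (g x - 1#) * prodL (map (λ a → g a - 1#) xs)       ∎
    where
    d = length xs
    w w′ : _ → Carrier
    w  s = pow (- 1#) (suc d ∸ length s) * prodL (map g s)
    w′ s = pow (- 1#) (d ∸ length s) * prodL (map g s)
    A = sublists xs
    E = sumL (map w′ A)
    sign-step : ∀ s → length s ≤ d → w s ≈ - 1# * w′ s
    sign-step s |s|≤d rewrite ℕP.+-∸-assoc 1 |s|≤d = *-assoc _ _ _

  -- The two identities for 1/(1 - y)

  inverse-shift : ∀ {y g} → (1# - y) * g ≈ 1# → g - 1# ≈ y * g
  inverse-shift {y} {g} [1-y]g≈1 = begin
    g - 1#            ≈⟨ +-congˡ (-‿cong (trans (sym ([1-y]x≈x-yx g y)) [1-y]g≈1)) ⟨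
    g - (g - y * g)   ≈⟨ +-congˡ (⁻¹-anti-homo‿- g (y * g)) ⟩
    g + (y * g - g)   ≈⟨ +-assoc g (y * g) (- g) ⟨
    g + y * g - g     ≈⟨ xyx⁻¹≈y g (y * g) ⟩
    y * g             ∎

  inverse-reflection : ∀ {y y′ h} → y * y′ ≈ 1# → (1# - y′) * h ≈ 1# → (1# - y) * (1# - h) ≈ 1#
  inverse-reflection {y} {y′} {h} yy′≈1 [1-y′]h≈1 = begin
    (1# - y) * (1# - h)           ≈⟨ x[y-z]≈xy-xz _ 1# h ⟩
    (1# - y) * 1# - (1# - y) * h  ≈⟨ +-cong (*-identityʳ _) (-‿cong [1-y]h≈-y) ⟩
    (1# - y) - (- y)              ≈⟨ +-congˡ (⁻¹-involutive y) ⟩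
    (1# - y) + y                  ≈⟨ +-assoc 1# (- y) y ⟩
    1# + (- y + y)                ≈⟨ +-congˡ (-‿inverseˡ y) ⟩
    1# + 0#                       ≈⟨ +-identityʳ 1# ⟩
    1#                            ∎
    where
    1-y≈-y[1-y′] : 1# - y ≈ (- y) * (1# - y′)
    1-y≈-y[1-y′] = sym (begin
      (- y) * (1# - y′)              ≈⟨ *-comm (- y) _ ⟩
      (1# - y′) * (- y)              ≈⟨ [1-y]x≈x-yx (- y) y′ ⟩
      - y - y′ * (- y)               ≈⟨ +-congˡ (-‿cong (sym (-‿distribʳ-* y′ y))) ⟩
      - y - - (y′ * y)               ≈⟨ +-congˡ (⁻¹-involutive _) ⟩
      - y + y′ * y                   ≈⟨ +-congˡ (trans (*-comm y′ y) yy′≈1) ⟩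
      - y + 1#                       ≈⟨ +-comm _ _ ⟩
      1# - y                         ∎)
    [1-y]h≈-y : (1# - y) * h ≈ - y
    [1-y]h≈-y = begin
      (1# - y) * h                ≈⟨ *-congʳ 1-y≈-y[1-y′] ⟩
      ((- y) * (1# - y′)) * h     ≈⟨ *-assoc _ _ _ ⟩
      (- y) * ((1# - y′) * h)     ≈⟨ *-congˡ [1-y′]h≈1 ⟩
      (- y) * 1#                  ≈⟨ *-identityʳ _ ⟩
      - y                         ∎

  -- Fourier–Dedekind sums at a primitive root of unity ξ of order b = b₀ + 1

  module AtPrimitiveRoot (b₀ : ℕ) (ξ : Carrier) (prim : IsPrimitiveRoot ξ (suc b₀)) where

    b : ℕ
    b = suc b₀

    ξ^b≈1 : pow ξ b ≈ 1#
    ξ^b≈1 = proj₁ prim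

    ξ≉0 : ¬ (ξ ≈ 0#)
    ξ≉0 = unit⇒≉0 ξ^b≈1

    pow-mod : ∀ m → pow ξ m ≈ pow ξ (m % b)
    pow-mod m = begin
      pow ξ m                                ≡⟨ PE.cong (pow ξ) (m≡m%n+[m/n]*n m b) ⟩
      pow ξ (m % b ℕ.+ (m / b) ℕ.* b)        ≈⟨ pow-+ ξ (m % b) _ ⟩
      pow ξ (m % b) * pow ξ ((m / b) ℕ.* b)  ≡⟨ PE.cong (λ k → pow ξ (m % b) * pow ξ k) (ℕP.*-comm (m / b) b) ⟩
      pow ξ (m % b) * pow ξ (b ℕ.* (m / b))  ≈⟨ *-congˡ (pow-* ξ b (m / b)) ⟨
      pow ξ (m % b) * pow (pow ξ b) (m / b)  ≈⟨ *-congˡ (trans (pow-cong (m / b) ξ^b≈1) (pow-1# (m / b))) ⟩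
      pow ξ (m % b) * 1#                     ≈⟨ *-identityʳ _ ⟩
      pow ξ (m % b)                          ∎

    -- For 0 < j < b and a coprime to b, ξ^{ja} ≠ 1.  If b ∣ ja then b ∣ j,
    -- impossible as 0 < j < b; otherwise ξ^{ja mod b} = 1 with
    -- 0 < ja mod b < b contradicts primitivity.
    root-power-≉1 : ∀ j a → 0 < j → j < b → Coprime a b → ¬ (pow (pow ξ j) a ≈ 1#)
    root-power-≉1 j a 0<j j<b a⊥b ξ^ja≈1 with (j ℕ.* a) % b ℕP.≟ 0
    ... | yes ja%b≡0 = ℕP.<-irrefl PE.refl (ℕP.<-≤-trans j<b (∣⇒≤ ⦃ ℕ.>-nonZero 0<j ⦄ b∣j))
      where
      b∣j : b ∣ j
      b∣j = coprime-divisor (Coprimality.sym a⊥b)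
              (PE.subst (b ∣_) (ℕP.*-comm j a) (m%n≡0⇒n∣m _ b ja%b≡0))
    ... | no ja%b≢0 = proj₂ prim ((j ℕ.* a) % b) (ℕP.n≢0⇒n>0 ja%b≢0) (m%n<n (j ℕ.* a) b)
          (trans (sym (pow-mod (j ℕ.* a))) (trans (sym (pow-* ξ j a)) ξ^ja≈1))

    g : ℕ → ℕ → Carrier
    g j a = (1# - pow (pow ξ j) a) ⁻¹

    g-inverse : ∀ j a → 0 < j → j < b → Coprime a b → (1# - pow (pow ξ j) a) * g j a ≈ 1#
    g-inverse j a 0<j j<b a⊥b = ⁻¹-inverse _ (1-y≉0 (root-power-≉1 j a 0<j j<b a⊥b))

    summand : ℤ → ℕ → List ℕ → Carrier
    summand n j s = zpow (pow ξ j) n * prodL (map (g j) s)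

    summand-reflect : ∀ j j′ → 0 < j → 0 < j′ → j ℕ.+ j′ ≡ b → ∀ t as → All (λ a → Coprime a b) as →
      summand (ℤ.- t) j as ≈ zpow (pow ξ j′) t * prodL (map (λ a → 1# - g j′ a) as)
    summand-reflect j j′ 0<j 0<j′ j+j′≡b t as as⊥b =
      *-cong (zpow-neg ξʲξʲ′≈1 t) (prodL-congAll as as⊥b reflect-factor)
      where
      j<b : j < b
      j<b = PE.subst (j <_) j+j′≡b (ℕP.m<m+n j 0<j′)
      j′<b : j′ < b
      j′<b = PE.subst (j′ <_) j+j′≡b (ℕP.m<n+m j′ 0<j)
      ξʲξʲ′≈1 : pow ξ j * pow ξ j′ ≈ 1#
      ξʲξʲ′≈1 = trans (sym (pow-+ ξ j j′)) (trans (reflexive (PE.cong (pow ξ) j+j′≡b)) ξ^b≈1)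
      reflect-factor : ∀ a → Coprime a b → g j a ≈ 1# - g j′ a
      reflect-factor a a⊥b = inverse-unique (g-inverse j a 0<j j<b a⊥b)
        (inverse-reflection (pow-inverse a ξʲξʲ′≈1) (g-inverse j′ a 0<j′ j′<b a⊥b))

    summand-shift : ∀ j → 0 < j → j < b → ∀ t as → All (λ a → Coprime a b) as →
      summand (t ℤ.+ + sum as) j as ≈ zpow (pow ξ j) t * prodL (map (λ a → g j a - 1#) as)
    summand-shift j 0<j j<b t as as⊥b = sym (begin
      zpow x t * prodL (map (λ a → g j a - 1#) as)
        ≈⟨ *-congˡ (prodL-congAll as as⊥b (λ a a⊥b → inverse-shift (g-inverse j a 0<j j<b a⊥b))) ⟩
      zpow x t * prodL (map (λ a → pow x a * g j a) as)     ≈⟨ *-congˡ (prodL-pow-split x (g j) as) ⟩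
      zpow x t * (pow x (sum as) * prodL (map (g j) as))    ≈⟨ *-assoc _ _ _ ⟨
      (zpow x t * pow x (sum as)) * prodL (map (g j) as)    ≈⟨ *-congʳ (zpow-+ (pow-≉0 j ξ≉0) t (sum as)) ⟨
      zpow x (t ℤ.+ + sum as) * prodL (map (g j) as)        ∎)
      where
      x : Carrier
      x = pow ξ j

    signedSubsetSum-fourier : ∀ as t (sign : ℕ → Carrier) →
      signedSubsetSum ξ b as t sign ≈
      fromℕ b ⁻¹ * sumFrom 1 b₀ (λ j → zpow (pow ξ j) t *
        sumL (map (λ s → sign (length s) * prodL (map (g j) s)) (sublists as)))
    signedSubsetSum-fourier as t sign = begin
      signedSubsetSum ξ b as t sign
        ≈⟨ sum-by-size length (length as) sign (λ s → S ξ b s t) L (sublists-length as) ⟩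
      sumL (map (λ s → sign (length s) * S ξ b s t) L)
        ≈⟨ sumL-cong L move-sign-inside ⟩
      sumL (map (λ s → b⁻¹ * sumFrom 1 b₀ (λ j → zpow (pow ξ j) t * (sign (length s) * P j s))) L)
        ≈⟨ sumL-*ˡ b⁻¹ _ L ⟩
      b⁻¹ * sumL (map (λ s → sumFrom 1 b₀ (λ j → zpow (pow ξ j) t * (sign (length s) * P j s))) L)
        ≈⟨ *-congˡ (sumL-sumFrom-comm 1 b₀ _ L) ⟩
      b⁻¹ * sumFrom 1 b₀ (λ j → sumL (map (λ s → zpow (pow ξ j) t * (sign (length s) * P j s)) L))
        ≈⟨ *-congˡ (sumFrom-cong 1 b₀ (λ j → sumL-*ˡ (zpow (pow ξ j) t) _ L)) ⟩
      b⁻¹ * sumFrom 1 b₀ (λ j → zpow (pow ξ j) t * sumL (map (λ s → sign (length s) * P j s) L)) ∎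
      where
      L : List (List ℕ)
      L = sublists as
      b⁻¹ : Carrier
      b⁻¹ = fromℕ b ⁻¹
      P : ℕ → List ℕ → Carrier
      P j s = prodL (map (g j) s)
      move-sign-inside : ∀ s → sign (length s) * S ξ b s t
        ≈ b⁻¹ * sumFrom 1 b₀ (λ j → zpow (pow ξ j) t * (sign (length s) * P j s))
      move-sign-inside s = begin
        w * (b⁻¹ * sumFrom 1 b₀ (λ j → summand t j s))   ≈⟨ x∙yz≈y∙xz _ _ _ ⟩
        b⁻¹ * (w * sumFrom 1 b₀ (λ j → summand t j s))   ≈⟨ *-congˡ (sumFrom-*ˡ 1 b₀ w _) ⟨
        b⁻¹ * sumFrom 1 b₀ (λ j → w * summand t j s)     ≈⟨ *-congˡ (sumFrom-cong 1 b₀ (λ j → x∙yz≈y∙xz _ _ _)) ⟩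
        b⁻¹ * sumFrom 1 b₀ (λ j → zpow (pow ξ j) t * (w * P j s)) ∎
        where
        w : Carrier
        w = sign (length s)

    reciprocity-neg : ∀ as → All (λ a → Coprime a b) as → ∀ t →
      S ξ b as (ℤ.- t) ≈ signedSubsetSum ξ b as t (λ k → pow (- 1#) k)
    reciprocity-neg as as⊥b t = sym (begin
      signedSubsetSum ξ b as t (λ k → pow (- 1#) k)       ≈⟨ signedSubsetSum-fourier as t _ ⟩
      fromℕ b ⁻¹ * sumFrom 1 b₀ (λ j → zpow (pow ξ j) t *
        sumL (map (λ s → pow (- 1#) (length s) * prodL (map (g j) s)) (sublists as)))
        ≈⟨ *-congˡ (sumFrom-cong 1 b₀ (λ j → *-congˡ (expand-1-g (g j) as))) ⟩
      fromℕ b ⁻¹ * sumFrom 1 b₀ reflected                  ≈⟨ *-congˡ (sumFrom-cong-range 1 b₀ reflect-term) ⟨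
      fromℕ b ⁻¹ * sumFrom 1 b₀ (λ j → summand (ℤ.- t) (b ∸ j) as)
        ≈⟨ *-congˡ (sumFrom-reflect b₀ (λ j → summand (ℤ.- t) j as)) ⟨
      S ξ b as (ℤ.- t)                                    ∎)
      where
      reflected : ℕ → Carrier
      reflected j = zpow (pow ξ j) t * prodL (map (λ a → 1# - g j a) as)
      reflect-term : ∀ j → 1 ≤ j → j < b → summand (ℤ.- t) (b ∸ j) as ≈ reflected j
      reflect-term j 1≤j j<b =
        summand-reflect (b ∸ j) j (ℕP.m<n⇒0<n∸m j<b) 1≤j (ℕP.m∸n+n≡m (ℕP.<⇒≤ j<b)) t as as⊥b

    reciprocity-shift : ∀ as → All (λ a → Coprime a b) as → ∀ t →
      S ξ b as (t ℤ.+ + sum as) ≈ signedSubsetSum ξ b as t (λ k → pow (- 1#) (length as ∸ k))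
    reciprocity-shift as as⊥b t = sym (begin
      signedSubsetSum ξ b as t (λ k → pow (- 1#) (length as ∸ k))  ≈⟨ signedSubsetSum-fourier as t _ ⟩
      fromℕ b ⁻¹ * sumFrom 1 b₀ (λ j → zpow (pow ξ j) t *
        sumL (map (λ s → pow (- 1#) (length as ∸ length s) * prodL (map (g j) s)) (sublists as)))
        ≈⟨ *-congˡ (sumFrom-cong 1 b₀ (λ j → *-congˡ (expand-g-1 (g j) as))) ⟩
      fromℕ b ⁻¹ * sumFrom 1 b₀ (λ j → zpow (pow ξ j) t * prodL (map (λ a → g j a - 1#) as))
        ≈⟨ *-congˡ (sumFrom-cong-range 1 b₀ (λ j 1≤j j<b → summand-shift j 1≤j j<b t as as⊥b)) ⟨
      S ξ b as (t ℤ.+ + sum as)                                    ∎)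

open FourierDedekindProperties using (module AtPrimitiveRoot)

-- The theorem: both parts at the root ξ of order b = b₀ + 1 (the bound b ≥ 2
-- only serves to write b in this form).
lemma22 : ∀ {c ℓ} (F : Field c ℓ) →
    let open Field F
        open FourierDedekind F
    in CharZero →
       (b : ℕ) → 2 ≤ b → (ξ : Carrier) → IsPrimitiveRoot ξ b →
       (as : List ℕ) → 1 ≤ length as →
       All (λ a → (0 < a) × Coprime a b) as →
       (t : ℤ) →
       (S ξ b as (ℤ.- t) ≈ signedSubsetSum ξ b as t (λ k → pow (- 1#) k))
       × (S ξ b as (t ℤ.+ + sum as) ≈ signedSubsetSum ξ b as t (λ k → pow (- 1#) (length as ∸ k)))
lemma22 F _ (suc b₀) _ ξ prim as _ admissible t =
  reciprocity-neg as as⊥b t , reciprocity-shift as as⊥b t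
  where
  open AtPrimitiveRoot F b₀ ξ prim
  as⊥b : All (λ a → Coprime a (suc b₀)) as
  as⊥b = All.map proj₂ admissible
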